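{- Consider any execution of the Happy Swap Algorithm on a token swapping instance whose graph $G$ is a tree. If a move of a token $t$ is redundant, then it has the form $t\to v'$ with $d(v',v_f(t))\le 1$.
   Context: A token swapping instance consists of a tree $G=(V,E)$ with $n$ vertices, a set $T$ of $n$ tokens, and bijections $v_0,v_f:T\to V$ (starting and destination vertices); at all times each vertex holds one token, $v(t)$ denotes the current vertex of $t$, and initially $v(t)=v_0(t)$. A swap of adjacent tokens $t_1,t_2$ (i.e. $(v(t_1),v(t_2))\in E$) exchanges their vertices; it consists of the two moves $t_1\to v(t_2)$ and $t_2\to v(t_1)$. $d$ denotes graph distance, $p(t)$ the unique path from $v_0(t)$ to $v_f(t)$, and $d(t)=d(v_0(t),v_f(t))$. A token $t$ is happy if $v(t)=v_f(t)$. A swap of $(t_1,t_2)$ is a happy swap if $d(v_f(t_1),v(t_2))=d(v_f(t_1),v(t_1))-1$ and $d(v_f(t_2),v(t_1))=d(v_f(t_2),v(t_2))-1$. It is a shove if one of the tokens, say $t_1$, is happy and $d(v_f(t_2),v(t_1))=d(v_f(t_2),v(t_2))-1$. The Happy Swap Algorithm repeatedly, while some token is not happy, performs an arbitrary available happy swap or shove. A move $t\to v$ is inevitable if it is among the first $d(t)$ moves of token $t$ during the execution, and redundant otherwise. -}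

module Defs where

open import Data.Nat using (ℕ; zero; suc; _≤_)
open import Data.Fin using (Fin; _≟_)
open import Data.Bool using (Bool; true; false; if_then_else_; _∨_)
open import Data.List using (List; []; _∷_; _∷ʳ_; length)
open import Data.List.Relation.Unary.Linked using (Linked)
open import Data.List.Relation.Unary.Unique.Propositional using (Unique)
open import Data.Product using (Σ; ∃; _×_; _,_)
open import Data.Sum using (_⊎_)
open import Data.Unit using (⊤)
open import Relation.Nullary using (¬_; does)
open import Relation.Binary.PropositionalEquality using (_≡_; _≢_)

module _ {n : ℕ} (Adj : Fin n → Fin n → Set) where

  data Walk : Fin n → Fin n → ℕ → Set where
    here : ∀ {u} → Walk u u 0
    step : ∀ {u w v k} → Adj u w → Walk w v k → Walk u v (suc k)

  Dist : Fin n → Fin n → ℕ → Set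
  Dist u v k = Walk u v k × (∀ m → Walk u v m → k ≤ m)

  Cycle : Fin n → List (Fin n) → Set
  Cycle x xs = (2 ≤ length xs) × Unique (x ∷ xs) × Linked Adj ((x ∷ xs) ∷ʳ x)

  record IsTree : Set where
    field
      symmetric  : ∀ u v → Adj u v → Adj v u
      irreflexive : ∀ u → ¬ Adj u u
      connected  : ∀ u v → ∃ λ k → Walk u v k
      acyclic    : ∀ x xs → ¬ Cycle x xs

  -- configurations: current vertex of each token
  Config : Set
  Config = Fin n → Fin n

  Swap : Set
  Swap = Fin n × Fin n

  applySwap : Config → Swap → Config
  applySwap c (a , b) t =
    if does (t ≟ a) then c b else (if does (t ≟ b) then c a else c t)

  run : Config → List Swap → Config
  run c []       = c
  run c (s ∷ ss) = run (applySwap c s) ss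

  moves : Fin n → List Swap → ℕ
  moves t []             = 0
  moves t ((a , b) ∷ ss) =
    if does (t ≟ a) ∨ does (t ≟ b) then suc (moves t ss) else moves t ss

  module _ (vf : Config) where

    Happy : Config → Fin n → Set
    Happy c t = c t ≡ vf t

    Approaches : Config → Fin n → Fin n → Set
    Approaches c a b = ∃ λ k → Dist (vf a) (c a) (suc k) × Dist (vf a) (c b) k

    HappySwap : Config → Fin n → Fin n → Set
    HappySwap c a b = Approaches c a b × Approaches c b a

    Shove : Config → Fin n → Fin n → Set
    Shove c a b = Happy c a × Approaches c b a

    ValidStep : Config → Swap → Set
    ValidStep c (a , b) =
      (∃ λ t → ¬ Happy c t) × Adj (c a) (c b) ×
      (HappySwap c a b ⊎ Shove c a b ⊎ Shove c b a)

    -- a (finite prefix of an) execution of the Happy Swap Algorithm from c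
    ValidRun : Config → List Swap → Set
    ValidRun c []       = ⊤
    ValidRun c (s ∷ ss) = ValidStep c s × ValidRun (applySwap c s) ss

{-# OPTIONS --safe #-}
module Submission where

-- Each move of a token is either a step towards its destination or a shove of the
-- (then happy) token to a neighbour of its destination. Hence after m moves a token
-- with d(t) = d is at distance d - m from v_f(t) as long as m ≤ d, and once m ≥ d it
-- stays within distance 1: a token at distance 1 can only step onto v_f(t), and one
-- on v_f(t) can only be shoved next to it.

open import Defs
open import Data.Nat using (ℕ; zero; suc; _+_; _≤_; _<_; z≤n; s≤s)
open import Data.Nat.Properties using (≤-antisym; ≤-refl; ≤-trans; n≤1+n; m≤n⇒m≤1+n; n≤0⇒n≡0; m≤n+m; +-suc; +-identityʳ; <-irrefl)
open import Data.Fin using (Fin; _≟_)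
open import Data.List using (List; []; _∷_; _++_)
open import Data.Product using (∃; _×_; _,_; proj₁; proj₂)
open import Data.Sum using (_⊎_; inj₁; inj₂; [_,_])
open import Data.Empty using (⊥-elim)
open import Function.Bundles using (_↔_; Inverse)
open import Relation.Nullary using (¬_; Dec; yes; no)
open import Relation.Nullary.Decidable using (_⊎-dec_)
open import Relation.Binary.PropositionalEquality using (_≡_; refl; sym; trans; cong; subst)

module TokenSwapping {n : ℕ} (Adj : Fin n → Fin n → Set) where

  Walk-snoc : ∀ {u v w k} → Walk Adj u v k → Adj v w → Walk Adj u w (suc k)
  Walk-snoc here        e = step e here
  Walk-snoc (step e′ w) e = step e′ (Walk-snoc w e)

  Walk-reverse : (∀ u v → Adj u v → Adj v u) → ∀ {u v k} → Walk Adj u v k → Walk Adj v u k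
  Walk-reverse sym-Adj here                 = here
  Walk-reverse sym-Adj (step {u} {w} e wlk) = Walk-snoc (Walk-reverse sym-Adj wlk) (sym-Adj u w e)

  Dist-sym : (∀ u v → Adj u v → Adj v u) → ∀ {u v k} → Dist Adj u v k → Dist Adj v u k
  Dist-sym sym-Adj (wlk , shortest) =
    Walk-reverse sym-Adj wlk , λ m wlk′ → shortest m (Walk-reverse sym-Adj wlk′)

  Dist-unique : ∀ {u v k k′} → Dist Adj u v k → Dist Adj u v k′ → k ≡ k′
  Dist-unique (wlk , shortest) (wlk′ , shortest′) = ≤-antisym (shortest _ wlk′) (shortest′ _ wlk)

  Dist-self : ∀ {u k} → Dist Adj u u k → k ≡ 0
  Dist-self (_ , shortest) = n≤0⇒n≡0 (shortest 0 here)

  Adj⇒Dist1 : (∀ u → ¬ Adj u u) → ∀ {u v} → Adj u v → Dist Adj u v 1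
  Adj⇒Dist1 irrefl-Adj {u} {v} e = step e here , shortest
    where
    shortest : ∀ m → Walk Adj u v m → 1 ≤ m
    shortest zero    here = ⊥-elim (irrefl-Adj u e)
    shortest (suc m) _    = s≤s z≤n

  Participant : Fin n → Swap Adj → Set
  Participant t (a , b) = t ≡ a ⊎ t ≡ b

  participant? : ∀ t s → Dec (Participant t s)
  participant? t (a , b) = (t ≟ a) ⊎-dec (t ≟ b)

  applySwap-left : ∀ c a b → applySwap Adj c (a , b) a ≡ c b
  applySwap-left c a b with a ≟ a
  ... | yes _   = refl
  ... | no a≢a = ⊥-elim (a≢a refl)

  -- Also when a ≡ b, since both tokens then sit on c a ≡ c b.
  applySwap-right : ∀ c a b → applySwap Adj c (a , b) b ≡ c a
  applySwap-right c a b with b ≟ a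
  ... | yes refl = refl
  ... | no _ with b ≟ b
  ...   | yes _   = refl
  ...   | no b≢b = ⊥-elim (b≢b refl)

  applySwap-bystander : ∀ c {t} s → ¬ Participant t s → applySwap Adj c s t ≡ c t
  applySwap-bystander c {t} (a , b) bystander with t ≟ a | t ≟ b
  ... | yes t≡a | _       = ⊥-elim (bystander (inj₁ t≡a))
  ... | no _    | yes t≡b = ⊥-elim (bystander (inj₂ t≡b))
  ... | no _    | no _    = refl

  moves-participant : ∀ {t} s ss → Participant t s → moves Adj t (s ∷ ss) ≡ suc (moves Adj t ss)
  moves-participant {t} (a , b) ss participant with t ≟ a | t ≟ b
  ... | yes _   | _       = refl
  ... | no _    | yes _   = refl
  ... | no t≢a  | no t≢b  = ⊥-elim ([ t≢a , t≢b ] participant)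

  moves-bystander : ∀ {t} s ss → ¬ Participant t s → moves Adj t (s ∷ ss) ≡ moves Adj t ss
  moves-bystander {t} (a , b) ss bystander with t ≟ a | t ≟ b
  ... | yes t≡a | _       = ⊥-elim (bystander (inj₁ t≡a))
  ... | no _    | yes t≡b = ⊥-elim (bystander (inj₂ t≡b))
  ... | no _    | no _    = refl

  data TokenMove (goal p q : Fin n) : Set where
    approach  : ∀ {k} → Dist Adj goal p (suc k) → Dist Adj goal q k → TokenMove goal p q
    shovedOff : p ≡ goal → Adj p q → TokenMove goal p q

  -- The position p of a token with d(t) = d after m of its moves.
  data Progress (goal : Fin n) (d m : ℕ) (p : Fin n) : Set where
    inevitable : ∀ {k} → Dist Adj goal p k → k + m ≡ d → Progress goal d m p
    nearGoal   : ∀ {k} → Dist Adj goal p k → k ≤ 1 → d ≤ m → Progress goal d m p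

  Progress-start : ∀ {goal d p} → Dist Adj goal p d → Progress goal d 0 p
  Progress-start {d = d} δ = inevitable δ (+-identityʳ d)

  Progress-step : (∀ u → ¬ Adj u u) → ∀ {goal d m p q} →
    Progress goal d m p → TokenMove goal p q → Progress goal d (suc m) q
  Progress-step _ (inevitable δ k+m≡d) (approach {k} δ₁ δ₂) with Dist-unique δ δ₁
  ... | refl = inevitable δ₂ (trans (+-suc k _) k+m≡d)
  Progress-step _ (nearGoal δ k≤1 d≤m) (approach {k} δ₁ δ₂) with Dist-unique δ δ₁
  ... | refl = nearGoal δ₂ (≤-trans (n≤1+n k) k≤1) (m≤n⇒m≤1+n d≤m)
  Progress-step irrefl-Adj (inevitable δ k+m≡d) (shovedOff refl e) with Dist-self δ
  ... | refl = nearGoal (Adj⇒Dist1 irrefl-Adj e) ≤-refl (subst (_≤ _) k+m≡d (n≤1+n _))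
  Progress-step irrefl-Adj (nearGoal _ _ d≤m) (shovedOff refl e) =
    nearGoal (Adj⇒Dist1 irrefl-Adj e) ≤-refl (m≤n⇒m≤1+n d≤m)

  Progress-redundant : ∀ {goal d m p} → Progress goal d m p → d < m → ∃ λ k → Dist Adj goal p k × k ≤ 1
  Progress-redundant (inevitable {k} _ k+m≡d) d<m =
    ⊥-elim (<-irrefl refl (≤-trans d<m (subst (_ ≤_) k+m≡d (m≤n+m _ k))))
  Progress-redundant (nearGoal δ k≤1 _) _ = _ , δ , k≤1

module HappySwapRun {n : ℕ} (Adj : Fin n → Fin n → Set)
                    (sym-Adj : ∀ u v → Adj u v → Adj v u) (irrefl-Adj : ∀ u → ¬ Adj u u)
                    (vf : Config Adj) where
  open TokenSwapping Adj

  ValidStep-left : ∀ {c a b} → ValidStep Adj vf c (a , b) → TokenMove (vf a) (c a) (c b)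
  ValidStep-left (_ , _ , inj₁ ((_ , δ₁ , δ₂) , _))           = approach δ₁ δ₂
  ValidStep-left (_ , e , inj₂ (inj₁ (happy , _)))            = shovedOff happy e
  ValidStep-left (_ , _ , inj₂ (inj₂ (_ , (_ , δ₁ , δ₂))))    = approach δ₁ δ₂

  ValidStep-right : ∀ {c a b} → ValidStep Adj vf c (a , b) → TokenMove (vf b) (c b) (c a)
  ValidStep-right (_ , _ , inj₁ (_ , (_ , δ₁ , δ₂)))          = approach δ₁ δ₂
  ValidStep-right (_ , _ , inj₂ (inj₁ (_ , (_ , δ₁ , δ₂))))   = approach δ₁ δ₂
  ValidStep-right (_ , e , inj₂ (inj₂ (happy , _)))           = shovedOff happy (sym-Adj _ _ e)

  ValidStep-participant : ∀ {c t} s → ValidStep Adj vf c s → Participant t s →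
    TokenMove (vf t) (c t) (applySwap Adj c s t)
  ValidStep-participant {c} (a , b) valid (inj₁ refl) =
    subst (TokenMove (vf a) (c a)) (sym (applySwap-left c a b)) (ValidStep-left valid)
  ValidStep-participant {c} (a , b) valid (inj₂ refl) =
    subst (TokenMove (vf b) (c b)) (sym (applySwap-right c a b)) (ValidStep-right valid)

  ValidRun-Progress : ∀ {c t d m} ss → ValidRun Adj vf c ss → Progress (vf t) d m (c t) →
    Progress (vf t) d (m + moves Adj t ss) (run Adj c ss t)
  ValidRun-Progress {c} {t} {d} {m} [] _ progress =
    subst (λ m′ → Progress (vf t) d m′ (c t)) (sym (+-identityʳ m)) progress
  ValidRun-Progress {c} {t} {d} {m} (s ∷ ss) (valid , validRun) progress with participant? t s
  ... | yes participant =
    subst (λ m′ → Progress (vf t) d m′ (run Adj c′ ss t)) shift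
      (ValidRun-Progress ss validRun
        (Progress-step irrefl-Adj progress (ValidStep-participant s valid participant)))
    where
    c′ : Config Adj
    c′ = applySwap Adj c s
    shift : suc m + moves Adj t ss ≡ m + moves Adj t (s ∷ ss)
    shift = trans (sym (+-suc m _)) (cong (m +_) (sym (moves-participant s ss participant)))
  ... | no bystander =
    subst (λ m′ → Progress (vf t) d (m + m′) (run Adj c′ ss t)) (sym (moves-bystander s ss bystander))
      (ValidRun-Progress ss validRun
        (subst (Progress (vf t) d m) (sym (applySwap-bystander c s bystander)) progress))
    where
    c′ : Config Adj
    c′ = applySwap Adj c s

  ValidRun-++ : ∀ {c} xs {ys} → ValidRun Adj vf c (xs ++ ys) →
    ValidRun Adj vf c xs × ValidRun Adj vf (run Adj c xs) ys
  ValidRun-++ []       valid              = _ , valid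
  ValidRun-++ (x ∷ xs) (validStep , valid) =
    let (validˡ , validʳ) = ValidRun-++ xs valid in (validStep , validˡ) , validʳ

mainTheorem6 : ∀ {n : ℕ} (Adj : Fin n → Fin n → Set) → IsTree Adj →
    (v₀ vf : Fin n ↔ Fin n) →
    (pre : List (Swap Adj)) (t₁ t₂ : Fin n) (rest : List (Swap Adj)) →
    ValidRun Adj (Inverse.to vf) (Inverse.to v₀) (pre ++ (t₁ , t₂) ∷ rest) →
    (t : Fin n) → (t ≡ t₁ ⊎ t ≡ t₂) →
    (∃ λ k → Dist Adj (Inverse.to v₀ t) (Inverse.to vf t) k × k ≤ moves Adj t pre) →
    ∃ λ k → Dist Adj (applySwap Adj (run Adj (Inverse.to v₀) pre) (t₁ , t₂) t) (Inverse.to vf t) k × k ≤ 1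
mainTheorem6 Adj tree v₀ vf pre t₁ t₂ rest valid t participant (d , δ₀ , redundant) =
  let (k , δ , k≤1) = Progress-redundant after (s≤s redundant) in k , Dist-sym symmetric δ , k≤1
  where
  open IsTree tree
  open TokenSwapping Adj
  open HappySwapRun Adj symmetric irreflexive (Inverse.to vf)
  c : Config Adj
  c = run Adj (Inverse.to v₀) pre
  validPre : ValidRun Adj (Inverse.to vf) (Inverse.to v₀) pre
  validPre = proj₁ (ValidRun-++ pre valid)
  validStep : ValidStep Adj (Inverse.to vf) c (t₁ , t₂)
  validStep = proj₁ (proj₂ (ValidRun-++ pre valid))
  before : Progress (Inverse.to vf t) d (moves Adj t pre) (c t)
  before = ValidRun-Progress pre validPre (Progress-start (Dist-sym symmetric δ₀))
  after : Progress (Inverse.to vf t) d (suc (moves Adj t pre)) (applySwap Adj c (t₁ , t₂) t)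
  after = Progress-step irreflexive before (ValidStep-participant (t₁ , t₂) validStep participant)
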